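{- Let $r\ge 3$ and let $G$ be a connected $\{K_{1,r},Z_1\}$-free graph on $n$ vertices with a vertex of degree at least $r$. Then $G$ is $(n-r+1)$-connected.
   Context: All graphs are finite and simple. $K_{1,r}$ is the star with $r$ leaves. $Z_1$ is the graph obtained from $K_{1,3}$ by adding one edge between two of its leaves. A graph is $\{K_{1,r},Z_1\}$-free if it has no induced subgraph isomorphic to $K_{1,r}$ or $Z_1$. -}

module Defs where

open import Data.Nat using (ℕ; _<_)
open import Data.Bool using (Bool; true; false)
open import Data.Fin using (Fin)
open import Data.Fin.Subset using (Subset; _∈_; _∉_; ∣_∣; ⊥)
open import Data.Vec using (tabulate)
open import Data.Product using (Σ; ∃; _×_)
open import Relation.Binary.PropositionalEquality using (_≡_; _≢_)
open import Relation.Nullary using (¬_)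
open import Function.Definitions using (Injective)

record Graph (n : ℕ) : Set where
  field
    adj    : Fin n → Fin n → Bool
    sym    : ∀ u v → adj u v ≡ adj v u
    irrefl : ∀ v → adj v v ≡ false
open Graph public

module _ {n : ℕ} (G : Graph n) where

  N : Fin n → Subset n
  N v = tabulate (adj G v)

  deg : Fin n → ℕ
  deg v = ∣ N v ∣

  data Walk (S : Subset n) : Fin n → Fin n → Set where
    here : ∀ {u} → u ∉ S → Walk S u u
    step : ∀ {u w v} → u ∉ S → adj G u w ≡ true → Walk S w v → Walk S u v

  ConnectedWithout : Subset n → Set
  ConnectedWithout S = ∀ u v → u ∉ S → v ∉ S → Walk S u v

  Connected : Set
  Connected = ConnectedWithout ⊥

  _-Connected : ℕ → Set
  _-Connected k = k < n × (∀ (S : Subset n) → ∣ S ∣ < k → ConnectedWithout S)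

  InducedStar : ℕ → Set
  InducedStar r = Σ (Fin n) λ c → Σ (Fin r → Fin n) λ l →
      Injective _≡_ _≡_ l
    × (∀ i → adj G c (l i) ≡ true)
    × (∀ i j → i ≢ j → adj G (l i) (l j) ≡ false)

  -- induced Z_1: centre a adjacent to b, c, d; b ~ c; d adjacent to neither b nor c
  -- (distinctness of a,b,c,d follows from the (non)adjacencies)
  InducedZ1 : Set
  InducedZ1 = Σ (Fin n) λ a → Σ (Fin n) λ b → Σ (Fin n) λ c → Σ (Fin n) λ d →
      adj G a b ≡ true × adj G a c ≡ true × adj G a d ≡ true
    × adj G b c ≡ true × adj G b d ≡ false × adj G c d ≡ false

  K1r-Z1-Free : ℕ → Set
  K1r-Z1-Free r = ¬ InducedStar r × ¬ InducedZ1

module Submission where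

-- Let G be connected and {K_{1,r}, Z_1}-free (Z_1 is the "paw")
-- with a vertex x₀ of degree ≥ r.
--   1. Among r neighbours of x₀ two must be adjacent (else K_{1,r}), so x₀
--      lies in a triangle.  In a paw-free graph "lies in a triangle" passes
--      to every neighbour, hence along walks to every vertex.
--   2. If every vertex lies in a triangle, paw-freeness forces: no neighbour
--      of a vertex q that misses an edge xy is adjacent to x.  Following a
--      walk from q to x this is impossible, so every vertex is adjacent to an
--      end of every edge (G has no induced K₂ ∪ K₁, i.e. G is co-P₃-free).
--   3. In a co-P₃-free graph a neighbour w of u is adjacent to all
--      non-neighbours of u, which are pairwise non-adjacent; so K_{1,r}-freeness
--      bounds the number of non-neighbours of every vertex by r − 1.
--   4. Deleting at most n − r vertices S then leaves G − S connected: two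
--      non-adjacent u, v ∉ S have too few non-neighbours for N(u) ⊆ S, and a
--      neighbour of u outside S is adjacent to v by co-P₃-freeness.
-- Finally deg x₀ ≥ r and x₀ ∉ N(x₀) give n > r ≥ 3, so n − r + 1 < n.

open import Defs
open import Data.Nat using (ℕ; zero; suc; _≤_; _<_; _∸_; _+_; z≤n; s≤s; _≤?_)
open import Data.Nat.Properties
  using (≤-trans; ≤-<-trans; <⇒≤; m∸[m∸n]≡n; ∸-monoʳ-≤; m∸n+n≡m; m<1+n⇒m≤n; +-comm; +-monoʳ-<; ≰⇒>; <⇒≱; module ≤-Reasoning)
open import Data.Fin using (Fin; zero; suc)
open import Data.Fin.Properties using (suc-injective; any?)
open import Data.Fin.Subset using (Subset; _∈_; _∉_; ∣_∣; ⊥; ∁; _⊆_; inside; outside)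
open import Data.Fin.Subset.Properties
  using (∉⊥; ∈⊤; ⊆⊤; ∣⊤∣≡n; p⊂q⇒∣p∣<∣q∣; p⊆q⇒∣p∣≤∣q∣; ∣∁p∣≡n∸∣p∣; x∈∁p⇒x∉p; _∈?_)
open import Data.Vec using ([]; _∷_; here; there)
open import Data.Vec.Properties using (lookup∘tabulate; []=⇒lookup; lookup⇒[]=)
open import Data.Bool using (true; false)
import Data.Bool as Bool
open import Data.Product using (Σ; ∃; _×_; _,_)
open import Data.Empty using (⊥-elim) renaming (⊥ to False)
open import Relation.Nullary using (¬_; yes; no)
open import Relation.Nullary.Decidable using (¬?; _×-dec_)
open import Relation.Binary.PropositionalEquality using (_≡_; _≢_; refl; trans; cong; subst)
import Relation.Binary.PropositionalEquality as ≡
open import Function.Definitions using (Injective)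

enumerate : ∀ {n r} (p : Subset n) → r ≤ ∣ p ∣
  → Σ (Fin r → Fin n) λ l → Injective _≡_ _≡_ l × (∀ i → l i ∈ p)
enumerate {r = zero} p _ = (λ ()) , (λ { {()} }) , (λ ())
enumerate {r = suc r} [] ()
enumerate {r = suc r} (outside ∷ p) r<∣p∣ with enumerate p r<∣p∣
... | l , l-inj , l∈p = (λ i → suc (l i)) , (λ eq → l-inj (suc-injective eq)) , (λ i → there (l∈p i))
enumerate {r = suc r} (inside ∷ p) (s≤s r≤∣p∣) with enumerate p r≤∣p∣
... | l , l-inj , l∈p = l′ , l′-inj , l′∈p
  where
  l′ : Fin (suc r) → Fin _
  l′ zero    = zero
  l′ (suc i) = suc (l i)
  l′-inj : Injective _≡_ _≡_ l′
  l′-inj {zero}  {zero}  _  = refl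
  l′-inj {suc i} {suc j} eq = cong suc (l-inj (suc-injective eq))
  l′-inj {zero}  {suc j} ()
  l′-inj {suc i} {zero}  ()
  l′∈p : ∀ i → l′ i ∈ inside ∷ p
  l′∈p zero    = here
  l′∈p (suc i) = there (l∈p i)

missing⇒∣p∣<n : ∀ {n x} {p : Subset n} → x ∉ p → ∣ p ∣ < n
missing⇒∣p∣<n {n} {x} {p} x∉p = subst (∣ p ∣ <_) (∣⊤∣≡n n) (p⊂q⇒∣p∣<∣q∣ (⊆⊤ , x , ∈⊤ , x∉p))

module _ {n : ℕ} (G : Graph n) where

  _∼_ _≁_ : Fin n → Fin n → Set
  u ∼ v = adj G u v ≡ true
  u ≁ v = adj G u v ≡ false

  ∼-sym : ∀ {u v} → u ∼ v → v ∼ u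
  ∼-sym {u} {v} uv = trans (sym G v u) uv

  ≁-sym : ∀ {u v} → u ≁ v → v ≁ u
  ≁-sym {u} {v} uv = trans (sym G v u) uv

  ∼-≁-exclusive : ∀ {u v} → u ∼ v → u ≁ v → False
  ∼-≁-exclusive uv uv̸ with () ← trans (≡.sym uv) uv̸

  ∼⇒∈N : ∀ {u v} → u ∼ v → v ∈ N G u
  ∼⇒∈N {u} {v} uv = lookup⇒[]= v _ (trans (lookup∘tabulate (adj G u) v) uv)

  ∈N⇒∼ : ∀ {u v} → v ∈ N G u → u ∼ v
  ∈N⇒∼ {u} {v} v∈N = trans (≡.sym (lookup∘tabulate (adj G u) v)) ([]=⇒lookup v∈N)

  ∉N-self : ∀ {v} → v ∉ N G v
  ∉N-self {v} v∈N = ∼-≁-exclusive (∈N⇒∼ v∈N) (irrefl G v)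

  ∈∁N⇒≁ : ∀ {u v} → v ∈ ∁ (N G u) → u ≁ v
  ∈∁N⇒≁ {u} {v} v∈∁N with adj G u v in uv
  ... | true  = ⊥-elim (x∈∁p⇒x∉p v∈∁N (∼⇒∈N uv))
  ... | false = refl

  CoP₃-Free : Set
  CoP₃-Free = ∀ {x y z} → x ∼ y → z ≁ x → z ≁ y → False

  InTriangle : Fin n → Set
  InTriangle v = Σ (Fin n) λ b → Σ (Fin n) λ c → v ∼ b × v ∼ c × b ∼ c

  triangle-at-high-degree : ∀ {r v} → ¬ InducedStar G r → r ≤ deg G v → InTriangle v
  triangle-at-high-degree {r} {v} noStar r≤deg
    with enumerate (N G v) r≤deg
  ... | l , l-inj , l∈N with any? (λ i → any? (λ j → adj G (l i) (l j) Bool.≟ true))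
  ...   | yes (i , j , lilj) = l i , l j , ∈N⇒∼ (l∈N i) , ∈N⇒∼ (l∈N j) , lilj
  ...   | no noEdge = ⊥-elim (noStar (v , l , l-inj , (λ i → ∈N⇒∼ (l∈N i)) , independent))
    where
    independent : ∀ i j → i ≢ j → l i ≁ l j
    independent i j _ with adj G (l i) (l j) in lilj
    ... | true  = ⊥-elim (noEdge (i , j , lilj))
    ... | false = refl

  module PawFree (noPaw : ¬ InducedZ1 G) where

    paw : ∀ {a b c d} → a ∼ b → a ∼ c → a ∼ d → b ∼ c → b ≁ d → c ≁ d → False
    paw {a} {b} {c} {d} ab ac ad bc bd cd = noPaw (a , b , c , d , ab , ac , ad , bc , bd , cd)

    triangle-spreads : ∀ {p w} → p ∼ w → InTriangle w → InTriangle p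
    triangle-spreads {p} {w} pw (b , c , wb , wc , bc) with adj G p b in pb | adj G p c in pc
    ... | true  | _     = w , b , pw , pb , wb
    ... | false | true  = w , c , pw , pc , wc
    ... | false | false = ⊥-elim (paw wb wc (∼-sym pw) bc (≁-sym pb) (≁-sym pc))

    triangle-along-walk : ∀ {p q} → Walk G ⊥ p q → InTriangle q → InTriangle p
    triangle-along-walk (here _)      t = t
    triangle-along-walk (step _ pw W) t = triangle-spreads pw (triangle-along-walk W t)

    module EveryVertexInTriangle (triangle : ∀ v → InTriangle v) where

      common-neighbour : ∀ {p x} → p ∼ x → Σ (Fin n) λ t → p ∼ t × x ∼ t
      common-neighbour {p} {x} px with triangle p
      ... | b , c , pb , pc , bc with adj G x b in xb | adj G x c in xc
      ...   | true  | _     = b , pb , xb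
      ...   | false | true  = c , pc , xc
      ...   | false | false = ⊥-elim (paw pb pc px bc (≁-sym xb) (≁-sym xc))

      miss-edge : ∀ {p x y q} → p ∼ x → x ∼ y → q ∼ p → q ≁ x → q ≁ y → False
      miss-edge {p} {x} {y} {q} px xy qp qx qy with adj G p y in py
      ... | true  = paw px py (∼-sym qp) xy (≁-sym qx) (≁-sym qy)
      ... | false with common-neighbour px
      ...   | t , pt , xt with adj G t y in ty
      ...     | false = paw (∼-sym px) xt xy pt py ty
      ...     | true with adj G t q in tq
      ...       | false = paw px pt (∼-sym qp) xt (≁-sym qx) tq
      ...       | true  = paw (∼-sym xt) ty tq xy (≁-sym qx) (≁-sym qy)

      miss-edge-walk : ∀ {z x y} → Walk G ⊥ z x → x ∼ y → z ≁ x → z ≁ y → False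
      miss-edge-walk (here _) xy _ x≁y = ∼-≁-exclusive xy x≁y
      miss-edge-walk {x = x} {y} (step {w = w} _ zw W) xy zx zy with adj G w x in wx | adj G w y in wy
      ... | true  | _     = miss-edge wx xy zw zx zy
      ... | false | true  = miss-edge wy (∼-sym xy) zw zy zx
      ... | false | false = miss-edge-walk W xy wx wy

      co-P₃-free : Connected G → CoP₃-Free
      co-P₃-free conn {x} {_} {z} = miss-edge-walk (conn z x ∉⊥ ∉⊥)

  module CoP₃ (coP₃ : CoP₃-Free) where

    few-non-neighbours : ∀ {r u w} → ¬ InducedStar G r → u ∼ w → ∣ ∁ (N G u) ∣ < r
    few-non-neighbours {r} {u} {w} noStar uw with r ≤? ∣ ∁ (N G u) ∣
    ... | no r≰ = ≰⇒> r≰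
    ... | yes r≤ with enumerate (∁ (N G u)) r≤
    ...   | l , l-inj , l∈∁N = ⊥-elim (noStar (w , l , l-inj , centre , independent))
      where
      centre : ∀ i → w ∼ l i
      centre i with adj G w (l i) in wl
      ... | true  = refl
      ... | false = ⊥-elim (coP₃ (∼-sym uw) (≁-sym wl) (≁-sym (∈∁N⇒≁ (l∈∁N i))))
      independent : ∀ i j → i ≢ j → l i ≁ l j
      independent i j _ with adj G (l i) (l j) in lilj
      ... | true  = ⊥-elim (coP₃ lilj (∈∁N⇒≁ (l∈∁N i)) (∈∁N⇒≁ (l∈∁N j)))
      ... | false = refl

    -- Step 4: if no vertex has r non-neighbours, deleting at most n − r
    -- vertices leaves G connected (any two survivors are at distance ≤ 2).
    robustly-connected : ∀ {r} → r ≤ n → (∀ u → ∣ ∁ (N G u) ∣ < r)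
      → ∀ (S : Subset n) → ∣ S ∣ ≤ n ∸ r → ConnectedWithout G S
    robustly-connected {r} r≤n few S ∣S∣≤ u v u∉S v∉S with adj G u v in uv
    ... | true  = step u∉S uv (here v∉S)
    ... | false with any? (λ w → (adj G u w Bool.≟ true) ×-dec ¬? (w ∈? S))
    ...   | yes (w , uw , w∉S) with adj G w v in wv
    ...     | true  = step u∉S uw (step w∉S wv (here v∉S))
    ...     | false = ⊥-elim (coP₃ uw (≁-sym uv) (≁-sym wv))
    robustly-connected {r} r≤n few S ∣S∣≤ u v u∉S v∉S | false | no noExit =
      ⊥-elim (<⇒≱ (few u) r≤∣∁N∣)
      where
      N⊆S : N G u ⊆ S
      N⊆S {w} w∈N with w ∈? S
      ... | yes w∈S = w∈S
      ... | no  w∉S = ⊥-elim (noExit (w , ∈N⇒∼ w∈N , w∉S))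
      r≤∣∁N∣ : r ≤ ∣ ∁ (N G u) ∣
      r≤∣∁N∣ = begin
        r                  ≡⟨ ≡.sym (m∸[m∸n]≡n r≤n) ⟩
        n ∸ (n ∸ r)        ≤⟨ ∸-monoʳ-≤ n (≤-trans (p⊆q⇒∣p∣≤∣q∣ N⊆S) ∣S∣≤) ⟩
        n ∸ ∣ N G u ∣      ≡⟨ ≡.sym (∣∁p∣≡n∸∣p∣ (N G u)) ⟩
        ∣ ∁ (N G u) ∣      ∎
        where open ≤-Reasoning

open PawFree
open EveryVertexInTriangle
open CoP₃

n∸r+1<n : ∀ {n r} → 2 ≤ r → r ≤ n → n ∸ r + 1 < n
n∸r+1<n {n} {r} 2≤r r≤n =
  subst (n ∸ r + 1 <_) (m∸n+n≡m r≤n) (+-monoʳ-< (n ∸ r) 2≤r)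

corollary2 : (r n : ℕ) → 3 ≤ r → (G : Graph n) → Connected G → K1r-Z1-Free G r
    → (∃ λ v → r ≤ deg G v) → _-Connected G (n ∸ r + 1)
corollary2 r n 3≤r G conn (noStar , noPaw) (x₀ , r≤deg) =
  n∸r+1<n (≤-trans (s≤s (s≤s z≤n)) 3≤r) r≤n , separators-large
  where
  triangle : ∀ v → InTriangle G v
  triangle v = triangle-along-walk G noPaw (conn v x₀ ∉⊥ ∉⊥)
                 (triangle-at-high-degree G noStar r≤deg)
  coP₃ : CoP₃-Free G
  coP₃ = co-P₃-free G noPaw triangle conn
  r<n : r < n
  r<n = ≤-<-trans r≤deg (missing⇒∣p∣<n (∉N-self G))
  r≤n : r ≤ n
  r≤n = <⇒≤ r<n
  separators-large : ∀ S → ∣ S ∣ < n ∸ r + 1 → ConnectedWithout G S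
  separators-large S ∣S∣< = robustly-connected G coP₃ r≤n few S
    (m<1+n⇒m≤n (subst (∣ S ∣ <_) (+-comm (n ∸ r) 1) ∣S∣<))
    where
    few : ∀ u → ∣ ∁ (N G u) ∣ < r
    few u with triangle u
    ... | _ , _ , uw , _ = few-non-neighbours G coP₃ noStar uw
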